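{- Let $p\geq 0$ and let $G$ be a nearly balanced bipartite graph of order $2n-1$. Then $G$ is $2p$-Hamilton-biconnected if and only if $cl_{n+p+1}(G)$ is $2p$-Hamilton-biconnected.
   Context: A bipartite graph $G=(X,Y;E)$ is nearly balanced if $|X|=|Y|+1$. A nearly balanced bipartite graph is Hamilton-biconnected if for any two distinct $u,v\in X$ it has a Hamiltonian path with end vertices $u$ and $v$. A set $W\subseteq V(G)$ is balanced if $|W\cap X|=|W\cap Y|$; $G$ is $2p$-Hamilton-biconnected if for every balanced $W$ with $|W|=2p$, the subgraph induced by $V(G)\setminus W$ is Hamilton-biconnected. For an integer $r$, the $r$-biclosure $cl_r(G)$ of a bipartite graph $G=(X,Y;E)$ is the unique smallest bipartite graph $H$ on the same vertex set and bipartition with $G\subseteq H$ such that $d_H(x)+d_H(y)<r$ for all non-adjacent $x\in X$, $y\in Y$; equivalently, it is obtained from $G$ by repeatedly joining non-adjacent $x\in X$, $y\in Y$ whose current degree sum is at least $r$, until no such pair remains. -}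

module Defs where

open import Data.Nat using (ℕ; zero; suc; _+_; _<_)
open import Data.Bool using (Bool; true; false)
open import Data.Fin using (Fin; zero; suc; inject₁; fromℕ)
open import Data.Fin.Subset using (Subset; _∈_; ∁; ∣_∣)
open import Data.Vec using (tabulate)
open import Data.Product using (Σ; ∃; _×_; _,_)
open import Relation.Binary.PropositionalEquality using (_≡_; _≢_)
open import Function.Definitions using (Injective)

-- A bipartite graph with parts X = Fin a and Y = Fin b, given by its
-- biadjacency matrix (E x y ≡ true iff xy is an edge).
BGraph : ℕ → ℕ → Set
BGraph a b = Fin a → Fin b → Bool

Adj : ∀ {a b} → BGraph a b → Fin a → Fin b → Set
Adj G x y = G x y ≡ true

degX : ∀ {a b} → BGraph a b → Fin a → ℕ
degX G x = ∣ tabulate (λ y → G x y) ∣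

degY : ∀ {a b} → BGraph a b → Fin b → ℕ
degY G y = ∣ tabulate (λ x → G x y) ∣

_⊆G_ : ∀ {a b} → BGraph a b → BGraph a b → Set
G ⊆G H = ∀ x y → Adj G x y → Adj H x y

BiClosed : ∀ {a b} → ℕ → BGraph a b → Set
BiClosed r H = ∀ x y → H x y ≡ false → degX H x + degY H y < r

IsBiclosure : ∀ {a b} → ℕ → BGraph a b → BGraph a b → Set
IsBiclosure r G H =
  (G ⊆G H) × BiClosed r H ×
  (∀ H′ → G ⊆G H′ → BiClosed r H′ → H ⊆G H′)

-- A Hamiltonian path, with end vertices u and v (both in X), of the
-- subgraph of G induced by the vertex sets SX ⊆ X, SY ⊆ Y.
-- It is x₀ y₀ x₁ y₁ … y_{k-1} x_k, given by f (the x's) and g (the y's).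
HamPath : ∀ {a b} → BGraph a b → Subset a → Subset b → Fin a → Fin a → Set
HamPath {a} {b} G SX SY u v =
  Σ ℕ λ k → Σ (Fin (suc k) → Fin a) λ f → Σ (Fin k → Fin b) λ g →
    Injective _≡_ _≡_ f × Injective _≡_ _≡_ g ×
    (∀ x → (x ∈ SX → ∃ λ i → f i ≡ x) × (∀ i → f i ≡ x → x ∈ SX)) ×
    (∀ y → (y ∈ SY → ∃ λ j → g j ≡ y) × (∀ j → g j ≡ y → y ∈ SY)) ×
    f zero ≡ u × f (fromℕ k) ≡ v ×
    (∀ j → Adj G (f (inject₁ j)) (g j) × Adj G (f (suc j)) (g j))

HamBiconnected : ∀ {a b} → BGraph a b → Subset a → Subset b → Set
HamBiconnected G SX SY =
  ∀ u v → u ∈ SX → v ∈ SX → u ≢ v → HamPath G SX SY u v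

HamBiconnected2p : ∀ {a b} → ℕ → BGraph a b → Set
HamBiconnected2p {a} {b} p G =
  ∀ (WX : Subset a) (WY : Subset b) → ∣ WX ∣ ≡ p → ∣ WY ∣ ≡ p →
    HamBiconnected G (∁ WX) (∁ WY)

-- Adding edges can only help, so the property passes from G to its closure. Conversely, the closure
-- is reached from G by adding, one at a time, edges xy with x ≁ y and d(x) + d(y) ≥ n + p + 1, so it
-- suffices that such an edge can be removed again: every Hamiltonian u–v path of (K + xy) − W yields
-- one of K − W. Reversing the path if necessary, it reads x₀ y₀ … x_i y_i … with x = x_i, y = y_i.
-- Outside W every neighbour of x is some y_t and every neighbour of y some x_s, and the path has at
-- most n − 1 − p vertices y_t; so if no t ≠ i had both x ~ y_t and x_{t+1} ~ y, then
-- d(x) + d(y) ≤ (n − 1 − p) + 1 + 2p = n + p. For such a t, trading the edges xy and y_t x_{t+1} for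
-- x y_t and x_{t+1} y and reversing the segment between them gives the required path of K − W.
module Submission where

open import Defs
open import Data.Nat using (ℕ; zero; suc; pred; _+_; _*_; _∸_; _≤_; _<_; z≤n; s≤s; z<s; _≤?_)
open import Data.Nat.Properties hiding (_≟_)
open import Data.Nat.Tactic.RingSolver using (solve-∀)
open import Algebra.Properties.Semiring.Sum +-*-semiring
  using (sum; sum-syntax; ∑-comm; ∑-distrib-+; sum-cong-≗; sum-replicate-zero; *-distribʳ-sum)
open import Data.Bool using (Bool; true; false; not; _∧_; _∨_)
open import Data.Bool.Properties as Boolₚ using (∨-zeroʳ)
open import Data.Fin using (Fin; zero; suc; toℕ; inject₁; fromℕ; fromℕ<)
open import Data.Fin.Properties as Finₚ using (_≟_)
open import Data.Fin.Subset using (Subset; _∈_; ∁; ∣_∣)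
open import Data.Fin.Subset.Properties using (x∈∁p⇒x∉p; x∉p⇒x∈∁p)
open import Data.Vec using (tabulate; lookup; []; _∷_)
open import Data.Vec.Properties using ([]=⇒lookup; lookup⇒[]=)
open import Data.Product using (∃; _×_; _,_; proj₁; proj₂)
open import Data.Sum using (_⊎_; inj₁; inj₂)
open import Function using (case_of_)
open import Function.Definitions using (Injective)
open import Relation.Nullary using (¬_; Dec; yes; no; does; contradiction)
open import Relation.Nullary.Decidable using (dec-true; dec-false; _×-dec_; ¬?)
open import Relation.Binary.Definitions using (tri<; tri≈; tri>)
open import Relation.Binary.PropositionalEquality

⟦_⟧ : Bool → ℕ
⟦ true ⟧ = 1
⟦ false ⟧ = 0

⟦⟧≤1 : ∀ b → ⟦ b ⟧ ≤ 1
⟦⟧≤1 true = s≤s z≤n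
⟦⟧≤1 false = z≤n

∑-mono-≤ : ∀ {n} {F G : Fin n → ℕ} → (∀ i → F i ≤ G i) → sum F ≤ sum G
∑-mono-≤ {zero} F≤G = z≤n
∑-mono-≤ {suc n} F≤G = +-mono-≤ (F≤G zero) (∑-mono-≤ (λ i → F≤G (suc i)))

∑-one : ∀ n → (∑[ i < n ] 1) ≡ n
∑-one zero = refl
∑-one (suc n) = cong suc (∑-one n)

term≤∑ : ∀ {n} (F : Fin n → ℕ) i → F i ≤ sum F
term≤∑ F zero = m≤m+n (F zero) _
term≤∑ F (suc i) = ≤-trans (term≤∑ (λ j → F (suc j)) i) (m≤n+m _ (F zero))

∑-decrement : ∀ {n} {F G : Fin n → ℕ} c → F c ≡ suc (G c) → (∀ i → i ≢ c → F i ≡ G i) →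
  sum F ≡ suc (sum G)
∑-decrement zero Fc≡1+Gc others = cong₂ _+_ Fc≡1+Gc (sum-cong-≗ (λ i → others (suc i) (λ ())))
∑-decrement {suc n} {F} {G} (suc c) Fc≡1+Gc others =
  trans (cong₂ _+_ (others zero (λ ()))
                   (∑-decrement c Fc≡1+Gc (λ i i≢c → others (suc i) (λ e → i≢c (Finₚ.suc-injective e)))))
        (+-suc (G zero) _)

∣tabulate∣≡∑ : ∀ {n} (h : Fin n → Bool) → ∣ tabulate h ∣ ≡ (∑[ i < n ] ⟦ h i ⟧)
∣tabulate∣≡∑ {zero} h = refl
∣tabulate∣≡∑ {suc n} h with h zero
... | true = cong suc (∣tabulate∣≡∑ (λ i → h (suc i)))
... | false = ∣tabulate∣≡∑ (λ i → h (suc i))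

∣∣≡∑ : ∀ {n} (W : Subset n) → ∣ W ∣ ≡ (∑[ i < n ] ⟦ lookup W i ⟧)
∣∣≡∑ [] = refl
∣∣≡∑ (true ∷ W) = cong suc (∣∣≡∑ W)
∣∣≡∑ (false ∷ W) = ∣∣≡∑ W

∈∁⇒lookup≡false : ∀ {n} {W : Subset n} {y} → y ∈ ∁ W → lookup W y ≡ false
∈∁⇒lookup≡false {W = W} {y} y∈∁W with lookup W y in e
... | true = contradiction (lookup⇒[]= y W e) (x∈∁p⇒x∉p y∈∁W)
... | false = refl

lookup≡false⇒∈∁ : ∀ {n} {W : Subset n} {y} → lookup W y ≡ false → y ∈ ∁ W
lookup≡false⇒∈∁ e = x∉p⇒x∈∁p (λ y∈W → case trans (sym ([]=⇒lookup y∈W)) e of λ ())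

δ : ∀ {n} → Fin n → Fin n → ℕ
δ i j = ⟦ does (i ≟ j) ⟧

∑-δ : ∀ {n} (c : Fin n) (F : Fin n → ℕ) → (∑[ j < n ] (δ c j * F j)) ≡ F c
∑-δ {suc n} zero F = trans (cong₂ _+_ (+-identityʳ (F zero)) (sum-replicate-zero n)) (+-identityʳ (F zero))
∑-δ {suc n} (suc c) F = ∑-δ c (λ j → F (suc j))

multiplicity : ∀ {k n} → (Fin k → Fin n) → Fin n → ℕ
multiplicity {k} g y = ∑[ t < k ] δ (g t) y

∑-reindex : ∀ {k n} (g : Fin k → Fin n) (F : Fin n → ℕ) →
  (∑[ t < k ] F (g t)) ≡ (∑[ y < n ] (multiplicity g y * F y))
∑-reindex {k} {n} g F = begin
  (∑[ t < k ] F (g t))                       ≡⟨ sum-cong-≗ (λ t → sym (∑-δ (g t) F)) ⟩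
  (∑[ t < k ] ∑[ y < n ] (δ (g t) y * F y))  ≡⟨ ∑-comm (λ t y → δ (g t) y * F y) ⟩
  (∑[ y < n ] ∑[ t < k ] (δ (g t) y * F y))  ≡⟨ sum-cong-≗ (λ y → sym (*-distribʳ-sum (F y) (λ t → δ (g t) y))) ⟩
  (∑[ y < n ] (multiplicity g y * F y))      ∎
  where open ≡-Reasoning

multiplicity≡0 : ∀ {k n} (g : Fin k → Fin n) y → (∀ t → g t ≢ y) → multiplicity g y ≡ 0
multiplicity≡0 {k} g y g≢y =
  trans (sum-cong-≗ (λ t → cong ⟦_⟧ (dec-false (g t ≟ y) (g≢y t)))) (sum-replicate-zero k)

multiplicity≥1 : ∀ {k n} (g : Fin k → Fin n) {y} t → g t ≡ y → 1 ≤ multiplicity g y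
multiplicity≥1 g {y} t gt≡y =
  ≤-trans (≤-reflexive (cong ⟦_⟧ (sym (dec-true (g t ≟ y) gt≡y)))) (term≤∑ (λ s → δ (g s) y) t)

multiplicity≤1 : ∀ {k n} {g : Fin k → Fin n} → Injective _≡_ _≡_ g → ∀ y → multiplicity g y ≤ 1
multiplicity≤1 {zero} _ y = z≤n
multiplicity≤1 {suc k} {g = g} g-inj y with g zero ≟ y
... | yes g0≡y = ≤-reflexive (cong suc (multiplicity≡0 (λ t → g (suc t)) y
                   (λ t gt≡y → Finₚ.0≢1+n (g-inj (trans g0≡y (sym gt≡y))))))
... | no _ = multiplicity≤1 (λ e → Finₚ.suc-injective (g-inj e)) y

∣tabulate∣≤∑∘+∣W∣ : ∀ {k n} (h : Fin n → Bool) (g : Fin k → Fin n) (W : Subset n) →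
  (∀ y → y ∈ ∁ W → ∃ λ t → g t ≡ y) →
  ∣ tabulate h ∣ ≤ (∑[ t < k ] ⟦ h (g t) ⟧) + ∣ W ∣
∣tabulate∣≤∑∘+∣W∣ {k} {n} h g W covers = begin
  ∣ tabulate h ∣
    ≡⟨ ∣tabulate∣≡∑ h ⟩
  (∑[ y < n ] ⟦ h y ⟧)
    ≤⟨ ∑-mono-≤ pointwise ⟩
  (∑[ y < n ] (multiplicity g y * ⟦ h y ⟧ + ⟦ lookup W y ⟧))
    ≡⟨ ∑-distrib-+ (λ y → multiplicity g y * ⟦ h y ⟧) (λ y → ⟦ lookup W y ⟧) ⟩
  (∑[ y < n ] (multiplicity g y * ⟦ h y ⟧)) + (∑[ y < n ] ⟦ lookup W y ⟧)
    ≡⟨ cong₂ _+_ (sym (∑-reindex g (λ y → ⟦ h y ⟧))) (sym (∣∣≡∑ W)) ⟩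
  (∑[ t < k ] ⟦ h (g t) ⟧) + ∣ W ∣
    ∎
  where
  open ≤-Reasoning
  pointwise : ∀ y → ⟦ h y ⟧ ≤ multiplicity g y * ⟦ h y ⟧ + ⟦ lookup W y ⟧
  pointwise y with lookup W y in e
  ... | true = ≤-trans (⟦⟧≤1 (h y)) (m≤n+m 1 _)
  ... | false with covers y (lookup≡false⇒∈∁ e)
  ... | t , gt≡y = begin
    ⟦ h y ⟧                         ≡⟨ *-identityˡ _ ⟨
    1 * ⟦ h y ⟧                     ≤⟨ *-monoˡ-≤ ⟦ h y ⟧ (multiplicity≥1 g t gt≡y) ⟩
    multiplicity g y * ⟦ h y ⟧      ≤⟨ m≤m+n _ 0 ⟩
    multiplicity g y * ⟦ h y ⟧ + 0  ∎

injective⇒k+∣W∣≤n : ∀ {k n} {g : Fin k → Fin n} (W : Subset n) → Injective _≡_ _≡_ g →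
  (∀ t → g t ∈ ∁ W) → k + ∣ W ∣ ≤ n
injective⇒k+∣W∣≤n {k} {n} {g} W g-inj avoids = begin
  k + ∣ W ∣
    ≡⟨ cong₂ _+_ (sym (∑-one k)) (∣∣≡∑ W) ⟩
  (∑[ t < k ] 1) + (∑[ y < n ] ⟦ lookup W y ⟧)
    ≡⟨ cong (_+ _) (∑-reindex g (λ _ → 1)) ⟩
  (∑[ y < n ] (multiplicity g y * 1)) + (∑[ y < n ] ⟦ lookup W y ⟧)
    ≡⟨ ∑-distrib-+ (λ y → multiplicity g y * 1) (λ y → ⟦ lookup W y ⟧) ⟨
  (∑[ y < n ] (multiplicity g y * 1 + ⟦ lookup W y ⟧))
    ≤⟨ ∑-mono-≤ pointwise ⟩
  (∑[ y < n ] 1)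
    ≡⟨ ∑-one n ⟩
  n ∎
  where
  open ≤-Reasoning
  g≢y : ∀ {y} → lookup W y ≡ true → ∀ t → g t ≢ y
  g≢y Wy≡true t gt≡y =
    case trans (sym Wy≡true) (trans (cong (lookup W) (sym gt≡y)) (∈∁⇒lookup≡false (avoids t))) of λ ()
  pointwise : ∀ y → multiplicity g y * 1 + ⟦ lookup W y ⟧ ≤ 1
  pointwise y with lookup W y in e
  ... | true = ≤-reflexive (cong (λ m → m * 1 + 1) (multiplicity≡0 g y (g≢y e)))
  ... | false = ≤-trans (≤-reflexive (trans (+-identityʳ _) (*-identityʳ _))) (multiplicity≤1 g-inj y)

addEdge : ∀ {a b} → BGraph a b → Fin a → Fin b → BGraph a b
addEdge K x y a b = does (a ≟ x) ∧ does (b ≟ y) ∨ K a b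

⊆-addEdge : ∀ {a b} (K : BGraph a b) x y → K ⊆G addEdge K x y
⊆-addEdge K x y a b Kab rewrite Kab = ∨-zeroʳ _

addEdge-new : ∀ {a b} (K : BGraph a b) x y → Adj (addEdge K x y) x y
addEdge-new K x y rewrite dec-true (x ≟ x) refl | dec-true (y ≟ y) refl = refl

addEdge-old : ∀ {a b} (K : BGraph a b) {x y a b} → ¬ (a ≡ x × b ≡ y) → addEdge K x y a b ≡ K a b
addEdge-old K {x} {y} {a} {b} ab≢xy with a ≟ x | b ≟ y
... | yes a≡x | yes b≡y = contradiction (a≡x , b≡y) ab≢xy
... | yes _ | no _ = refl
... | no _ | _ = refl

Adj-addEdge⇒Adj : ∀ {a b} (K : BGraph a b) {x y a b} →
  Adj (addEdge K x y) a b → ¬ (a ≡ x × b ≡ y) → Adj K a b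
Adj-addEdge⇒Adj K Lab ab≢xy = trans (sym (addEdge-old K ab≢xy)) Lab

nonEdges : ∀ {a b} → BGraph a b → ℕ
nonEdges {a} {b} K = ∑[ a′ < a ] ∑[ b′ < b ] ⟦ not (K a′ b′) ⟧

nonEdges-addEdge : ∀ {a b} (K : BGraph a b) {x y} → K x y ≡ false →
  nonEdges K ≡ suc (nonEdges (addEdge K x y))
nonEdges-addEdge {b = b} K {x} {y} Kxy≡false = ∑-decrement x
  (∑-decrement y (trans (cong (λ e → ⟦ not e ⟧) Kxy≡false)
                        (cong (λ e → suc ⟦ not e ⟧) (sym (addEdge-new K x y))))
                 (λ b′ b′≢y → unchanged (λ (_ , b′≡y) → b′≢y b′≡y)))
  (λ a′ a′≢x → sum-cong-≗ {b} (λ b′ → unchanged (λ (a′≡x , _) → a′≢x a′≡x)))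
  where
  unchanged : ∀ {a′ b′} → ¬ (a′ ≡ x × b′ ≡ y) → ⟦ not (K a′ b′) ⟧ ≡ ⟦ not (addEdge K x y a′ b′) ⟧
  unchanged ab≢xy = cong (λ e → ⟦ not e ⟧) (sym (addEdge-old K ab≢xy))

biclosure-reflects : ∀ {a b} r (P : BGraph a b → Set) →
  (∀ {G H} → G ⊆G H → P G → P H) →
  (∀ K x y → K x y ≡ false → r ≤ degX K x + degY K y → P (addEdge K x y) → P K) →
  ∀ {G H} → IsBiclosure r G H → P H → P G
biclosure-reflects r P P-mono P-addEdge {G} {H} (_ , _ , H-least) PH =
  grow (nonEdges G) G refl (λ _ _ e → e)
  where
  heavyNonEdge? : ∀ K → Dec (∃ λ x → ∃ λ y → K x y ≡ false × r ≤ degX K x + degY K y)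
  heavyNonEdge? K = Finₚ.any? λ x → Finₚ.any? λ y →
    (K x y Boolₚ.≟ false) ×-dec (r ≤? degX K x + degY K y)

  -- Once no heavy non-edge is left, K is biclosed, so it contains H.
  grow : ∀ n K → nonEdges K ≡ n → G ⊆G K → P K
  grow n K _ G⊆K with heavyNonEdge? K
  ... | no noHeavy = P-mono (H-least K G⊆K (λ x y Kxy → ≰⇒> (λ heavy → noHeavy (x , y , Kxy , heavy)))) PH
  grow zero K count _ | yes (x , y , Kxy , _) = case trans (sym count) (nonEdges-addEdge K Kxy) of λ ()
  grow (suc n) K count G⊆K | yes (x , y , Kxy , heavy) = P-addEdge K x y Kxy heavy
    (grow n (addEdge K x y) (suc-injective (trans (sym (nonEdges-addEdge K Kxy)) count))
          (λ a b e → ⊆-addEdge K x y a b (G⊆K a b e)))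

pattern hamPath k f g f-inj g-inj f-covers g-covers f₀≡u fₖ≡v edges =
  k , f , g , f-inj , g-inj , f-covers , g-covers , f₀≡u , fₖ≡v , edges

Covers : ∀ {k n} → Subset n → (Fin k → Fin n) → Set
Covers S f = ∀ z → (z ∈ S → ∃ λ i → f i ≡ z) × (∀ i → f i ≡ z → z ∈ S)

PathEdges : ∀ {a b k} → BGraph a b → (Fin (suc k) → Fin a) → (Fin k → Fin b) → Set
PathEdges G f g = ∀ j → Adj G (f (inject₁ j)) (g j) × Adj G (f (suc j)) (g j)

HamPath-mono : ∀ {a b} {G H : BGraph a b} {SX SY u v} →
  G ⊆G H → HamPath G SX SY u v → HamPath H SX SY u v
HamPath-mono G⊆H (hamPath k f g f-inj g-inj f-covers g-covers f₀≡u fₖ≡v edges) =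
  hamPath k f g f-inj g-inj f-covers g-covers f₀≡u fₖ≡v
    (λ j → G⊆H _ _ (proj₁ (edges j)) , G⊆H _ _ (proj₂ (edges j)))

HamBiconnected2p-mono : ∀ {a b} p {G H : BGraph a b} →
  G ⊆G H → HamBiconnected2p p G → HamBiconnected2p p H
HamBiconnected2p-mono p G⊆H G-ham WX WY ∣WX∣≡p ∣WY∣≡p u v u∈ v∈ u≢v =
  HamPath-mono G⊆H (G-ham WX WY ∣WX∣≡p ∣WY∣≡p u v u∈ v∈ u≢v)

module _ {n} {ρ : Fin n → Fin n} (ρ-involutive : ∀ i → ρ (ρ i) ≡ i) {c} (f : Fin n → Fin c) where

  ∘-involution-injective : Injective _≡_ _≡_ f → Injective _≡_ _≡_ (λ i → f (ρ i))
  ∘-involution-injective f-inj {i} {j} e =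
    trans (sym (ρ-involutive i)) (trans (cong ρ (f-inj e)) (ρ-involutive j))

  ∘-involution-covers : ∀ {S} → Covers S f → Covers S (λ i → f (ρ i))
  ∘-involution-covers f-covers z =
    (λ z∈S → let (i , fi≡z) = proj₁ (f-covers z) z∈S in ρ i , trans (cong f (ρ-involutive i)) fi≡z) ,
    (λ i → proj₂ (f-covers z) (ρ i))

permuted-path : ∀ {a b} {G : BGraph a b} {SX SY u v k} {f : Fin (suc k) → Fin a} {g : Fin k → Fin b} →
  Injective _≡_ _≡_ f → Injective _≡_ _≡_ g → Covers SX f → Covers SY g →
  (ρ : Fin (suc k) → Fin (suc k)) (τ : Fin k → Fin k) → (∀ i → ρ (ρ i) ≡ i) → (∀ j → τ (τ j) ≡ j) →
  f (ρ zero) ≡ u → f (ρ (fromℕ k)) ≡ v → PathEdges G (λ i → f (ρ i)) (λ j → g (τ j)) →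
  HamPath G SX SY u v
permuted-path {k = k} {f} {g} f-inj g-inj f-covers g-covers ρ τ ρ-inv τ-inv fρ₀≡u fρₖ≡v edges =
  hamPath k (λ i → f (ρ i)) (λ j → g (τ j))
    (∘-involution-injective ρ-inv f f-inj) (∘-involution-injective τ-inv g g-inj)
    (∘-involution-covers ρ-inv f f-covers) (∘-involution-covers τ-inv g g-covers) fρ₀≡u fρₖ≡v edges

reflect : ℕ → ℕ → ℕ → ℕ
reflect lo hi j with lo ≤? j | j ≤? hi
... | yes _ | yes _ = lo + hi ∸ j
... | _     | _     = j

reflect-inside : ∀ {lo hi j} → lo ≤ j → j ≤ hi → reflect lo hi j ≡ lo + hi ∸ j
reflect-inside {lo} {hi} {j} lo≤j j≤hi with lo ≤? j | j ≤? hi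
... | yes _ | yes _ = refl
... | no lo≰j | _ = contradiction lo≤j lo≰j
... | yes _ | no j≰hi = contradiction j≤hi j≰hi

reflect-below : ∀ {lo} hi {j} → j < lo → reflect lo hi j ≡ j
reflect-below {lo} hi {j} j<lo with lo ≤? j
... | yes lo≤j = contradiction lo≤j (<⇒≱ j<lo)
... | no _ = refl

reflect-above : ∀ lo {hi j} → hi < j → reflect lo hi j ≡ j
reflect-above lo {hi} {j} hi<j with lo ≤? j | j ≤? hi
... | _ | yes j≤hi = contradiction j≤hi (<⇒≱ hi<j)
... | yes _ | no _ = refl
... | no _ | no _ = refl

lo≤lo+hi∸j : ∀ lo {hi j} → j ≤ hi → lo ≤ lo + hi ∸ j
lo≤lo+hi∸j lo {hi} {j} j≤hi = ≤-trans (m≤m+n lo (hi ∸ j)) (≤-reflexive (sym (+-∸-assoc lo j≤hi)))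

lo+hi∸j≤hi : ∀ {lo} hi {j} → lo ≤ j → lo + hi ∸ j ≤ hi
lo+hi∸j≤hi {lo} hi {j} lo≤j = ≤-trans (∸-monoʳ-≤ (lo + hi) lo≤j) (≤-reflexive (m+n∸m≡n lo hi))

reflect-involutive : ∀ lo hi j → reflect lo hi (reflect lo hi j) ≡ j
reflect-involutive lo hi j = by-cases (lo ≤? j) (j ≤? hi)
  where
  fixed : reflect lo hi j ≡ j → reflect lo hi (reflect lo hi j) ≡ j
  fixed e = trans (cong (reflect lo hi) e) e
  by-cases : Dec (lo ≤ j) → Dec (j ≤ hi) → reflect lo hi (reflect lo hi j) ≡ j
  by-cases (yes lo≤j) (yes j≤hi) = begin
    reflect lo hi (reflect lo hi j)  ≡⟨ cong (reflect lo hi) (reflect-inside lo≤j j≤hi) ⟩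
    reflect lo hi (lo + hi ∸ j)      ≡⟨ reflect-inside (lo≤lo+hi∸j lo j≤hi) (lo+hi∸j≤hi hi lo≤j) ⟩
    lo + hi ∸ (lo + hi ∸ j)          ≡⟨ m∸[m∸n]≡n (≤-trans j≤hi (m≤n+m hi lo)) ⟩
    j                                ∎
    where open ≡-Reasoning
  by-cases (yes _) (no j≰hi) = fixed (reflect-above lo (≰⇒> j≰hi))
  by-cases (no lo≰j) _ = fixed (reflect-below hi (≰⇒> lo≰j))

reflect-< : ∀ {lo hi j n} → j < n → hi < n → reflect lo hi j < n
reflect-< {lo} {hi} {j} j<n hi<n with lo ≤? j | j ≤? hi
... | yes lo≤j | yes _ = ≤-<-trans (lo+hi∸j≤hi hi lo≤j) hi<n
... | yes _ | no _ = j<n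
... | no _ | _ = j<n

reflectFin : ∀ {n} lo hi → hi < n → Fin n → Fin n
reflectFin lo hi hi<n j = fromℕ< (reflect-< {lo} {hi} (Finₚ.toℕ<n j) hi<n)

toℕ-reflectFin : ∀ {n} lo hi (hi<n : hi < n) j → toℕ (reflectFin lo hi hi<n j) ≡ reflect lo hi (toℕ j)
toℕ-reflectFin lo hi hi<n j = Finₚ.toℕ-fromℕ< _

reflectFin-involutive : ∀ {n} lo hi (hi<n : hi < n) j →
  reflectFin lo hi hi<n (reflectFin lo hi hi<n j) ≡ j
reflectFin-involutive lo hi hi<n j = Finₚ.toℕ-injective (begin
  toℕ (ρ (ρ j))            ≡⟨ toℕ-reflectFin lo hi hi<n (ρ j) ⟩
  reflect lo hi (toℕ (ρ j)) ≡⟨ cong (reflect lo hi) (toℕ-reflectFin lo hi hi<n j) ⟩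
  reflect lo hi (reflect lo hi (toℕ j)) ≡⟨ reflect-involutive lo hi (toℕ j) ⟩
  toℕ j                    ∎)
  where
  open ≡-Reasoning
  ρ = reflectFin lo hi hi<n

OnPath : ℕ → ℕ → Set
OnPath A B = A ≡ B ⊎ A ≡ suc B

EdgePair : (ℕ → ℕ → Set) → (ℕ → ℕ) → (ℕ → ℕ) → ℕ → Set
EdgePair R ρ τ J = R (ρ J) (τ J) × R (ρ (suc J)) (τ J)

PathEdges⇒Adj : ∀ {a b k} {G : BGraph a b} {f : Fin (suc k) → Fin a} {g : Fin k → Fin b} →
  PathEdges G f g → ∀ i j → OnPath (toℕ i) (toℕ j) → Adj G (f i) (g j)
PathEdges⇒Adj {G = G} {f} {g} edges i j (inj₁ i≡j) = subst (λ i′ → Adj G (f i′) (g j))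
  (Finₚ.toℕ-injective (trans (Finₚ.toℕ-inject₁ j) (sym i≡j))) (proj₁ (edges j))
PathEdges⇒Adj {G = G} {f} {g} edges i j (inj₂ i≡1+j) = subst (λ i′ → Adj G (f i′) (g j))
  (Finₚ.toℕ-injective {i = suc j} (sym i≡1+j)) (proj₂ (edges j))

reflected-edges : ∀ {a b k} {G : BGraph a b} {f : Fin (suc k) → Fin a} {g : Fin k → Fin b} lo hi lo′ hi′
  (hi<1+k : hi < suc k) (hi′<k : hi′ < k) (R : ℕ → ℕ → Set) →
  (∀ i j → R (toℕ i) (toℕ j) → Adj G (f i) (g j)) →
  (∀ J → J < k → EdgePair R (reflect lo hi) (reflect lo′ hi′) J) →
  PathEdges G (λ i → f (reflectFin lo hi hi<1+k i)) (λ j → g (reflectFin lo′ hi′ hi′<k j))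
reflected-edges lo hi lo′ hi′ hi<1+k hi′<k R R⇒Adj pairs j =
  R⇒Adj _ _ (subst₂ R (sym x₁) (sym y) (proj₁ pair)) , R⇒Adj _ _ (subst₂ R (sym x₂) (sym y) (proj₂ pair))
  where
  pair = pairs (toℕ j) (Finₚ.toℕ<n j)
  x₁ : toℕ (reflectFin lo hi hi<1+k (inject₁ j)) ≡ reflect lo hi (toℕ j)
  x₁ = trans (toℕ-reflectFin lo hi hi<1+k (inject₁ j)) (cong (reflect lo hi) (Finₚ.toℕ-inject₁ j))
  x₂ : toℕ (reflectFin lo hi hi<1+k (suc j)) ≡ reflect lo hi (suc (toℕ j))
  x₂ = toℕ-reflectFin lo hi hi<1+k (suc j)
  y : toℕ (reflectFin lo′ hi′ hi′<k j) ≡ reflect lo′ hi′ (toℕ j)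
  y = toℕ-reflectFin lo′ hi′ hi′<k j

mirror : ∀ k → Fin (suc k) → Fin (suc k)
mirror k = reflectFin 0 k (n<1+n k)

mirror-inject : ∀ {k J} → J ≤ k → reflect 0 (suc k) J ≡ suc (reflect 0 k J)
mirror-inject {k} {J} J≤k = begin
  reflect 0 (suc k) J  ≡⟨ reflect-inside z≤n (m≤n⇒m≤1+n J≤k) ⟩
  suc k ∸ J            ≡⟨ +-∸-assoc 1 J≤k ⟩
  suc (k ∸ J)          ≡⟨ cong suc (reflect-inside z≤n J≤k) ⟨
  suc (reflect 0 k J)  ∎
  where open ≡-Reasoning

mirror-suc : ∀ {k J} → J ≤ k → reflect 0 (suc k) (suc J) ≡ reflect 0 k J
mirror-suc J≤k = trans (reflect-inside z≤n (s≤s J≤k)) (sym (reflect-inside z≤n J≤k))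

HamPath-reverse : ∀ {a b} {G : BGraph a b} {SX SY u v} → HamPath G SX SY u v → HamPath G SX SY v u
HamPath-reverse (hamPath zero f g f-inj g-inj f-covers g-covers f₀≡u fₖ≡v _) =
  hamPath zero f g f-inj g-inj f-covers g-covers fₖ≡v f₀≡u (λ ())
HamPath-reverse {G = G} (hamPath (suc k) f g f-inj g-inj f-covers g-covers f₀≡u fₖ≡v edges) =
  permuted-path {G = G} f-inj g-inj f-covers g-covers (mirror (suc k)) (mirror k)
    (reflectFin-involutive 0 (suc k) (n<1+n (suc k))) (reflectFin-involutive 0 k (n<1+n k))
    (trans (cong f first↦last) fₖ≡v) (trans (cong f last↦first) f₀≡u)
    (reflected-edges {G = G} {f} {g} 0 (suc k) 0 k (n<1+n (suc k)) (n<1+n k) OnPath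
      (PathEdges⇒Adj {G = G} {f} {g} edges)
      (λ J J<1+k → inj₂ (mirror-inject (≤-pred J<1+k)) , inj₁ (mirror-suc (≤-pred J<1+k))))
  where
  first↦last : mirror (suc k) zero ≡ fromℕ (suc k)
  first↦last = Finₚ.toℕ-injective (trans (toℕ-reflectFin 0 (suc k) (n<1+n (suc k)) zero)
                 (trans (reflect-inside z≤n z≤n) (sym (Finₚ.toℕ-fromℕ (suc k)))))
  last↦first : mirror (suc k) (fromℕ (suc k)) ≡ zero
  last↦first = Finₚ.toℕ-injective (trans (toℕ-reflectFin 0 (suc k) (n<1+n (suc k)) (fromℕ (suc k)))
                 (trans (cong (reflect 0 (suc k)) (Finₚ.toℕ-fromℕ (suc k)))
                        (trans (reflect-inside {0} {suc k} z≤n ≤-refl) (n∸n≡0 (suc k)))))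

PassesForward : ∀ {a b} {G : BGraph a b} {SX SY u v} → HamPath G SX SY u v → Fin a → Fin b → Set
PassesForward (hamPath k f g _ _ _ _ _ _ _) x y = ∃ λ i → f (inject₁ i) ≡ x × g i ≡ y

PassesBackward : ∀ {a b} {G : BGraph a b} {SX SY u v} → HamPath G SX SY u v → Fin a → Fin b → Set
PassesBackward (hamPath k f g _ _ _ _ _ _ _) x y = ∃ λ j → f (suc j) ≡ x × g j ≡ y

HamPath-reverse-passes : ∀ {a b} {G : BGraph a b} {SX SY u v x y} (P : HamPath G SX SY u v) →
  PassesBackward {G = G} P x y → PassesForward {G = G} (HamPath-reverse {G = G} P) x y
HamPath-reverse-passes (hamPath zero _ _ _ _ _ _ _ _ _) (() , _)
HamPath-reverse-passes (hamPath (suc k) f g _ _ _ _ _ _ _) (j , f[1+j]≡x , gj≡y) =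
  mirror k j , trans (cong f (Finₚ.toℕ-injective mirrored)) f[1+j]≡x ,
  trans (cong g (reflectFin-involutive 0 k (n<1+n k) j)) gj≡y
  where
  open ≡-Reasoning
  j′ = mirror k j
  mirrored : toℕ (mirror (suc k) (inject₁ j′)) ≡ suc (toℕ j)
  mirrored = begin
    toℕ (mirror (suc k) (inject₁ j′))        ≡⟨ toℕ-reflectFin 0 (suc k) (n<1+n (suc k)) (inject₁ j′) ⟩
    reflect 0 (suc k) (toℕ (inject₁ j′))     ≡⟨ cong (reflect 0 (suc k)) (Finₚ.toℕ-inject₁ j′) ⟩
    reflect 0 (suc k) (toℕ j′)               ≡⟨ mirror-inject (≤-pred (Finₚ.toℕ<n j′)) ⟩
    suc (reflect 0 k (toℕ j′))               ≡⟨ cong (λ m → suc (reflect 0 k m)) (toℕ-reflectFin 0 k (n<1+n k) j) ⟩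
    suc (reflect 0 k (reflect 0 k (toℕ j)))  ≡⟨ cong suc (reflect-involutive 0 k (toℕ j)) ⟩
    suc (toℕ j)                              ∎

-- (A, B) stands for the edge x_A y_B of a path on which the edge x_I y_I is xy; the rotated path may
-- use the old edges other than xy and the two new edges x y_T and x_{T+1} y.
data Rerouted (I T A B : ℕ) : Set where
  old-edge    : OnPath A B → ¬ (A ≡ I × B ≡ I) → Rerouted I T A B
  edge-x-yₜ   : A ≡ I → B ≡ T → Rerouted I T A B
  edge-xₜ₊₁-y : A ≡ suc T → B ≡ I → Rerouted I T A B

rerouted-at : ∀ {I T x₁ x₂ y A₁ A₂ B} → x₁ ≡ A₁ → x₂ ≡ A₂ → y ≡ B →
  Rerouted I T A₁ B × Rerouted I T A₂ B → Rerouted I T x₁ y × Rerouted I T x₂ y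
rerouted-at refl refl refl pair = pair

unchanged : ∀ {I T J} → J ≢ I → Rerouted I T J J × Rerouted I T (suc J) J
unchanged J≢I = old-edge (inj₁ refl) (λ (J≡I , _) → J≢I J≡I) ,
                old-edge (inj₂ refl) (λ (1+J≡I , J≡I) → 1+n≢n (trans 1+J≡I (sym J≡I)))

-- For i < t the rotated path is x₀ … x_i y_t x_t … y_{i+1} x_{i+1} y_i x_{t+1} …
rerouted-forward : ∀ {I T} → I < T → ∀ J → EdgePair (Rerouted I T) (reflect (suc I) T) (reflect I T) J
rerouted-forward {I} {T} I<T J with <-cmp J I
... | tri< J<I _ _ = rerouted-at (reflect-below T (m<n⇒m<1+n J<I)) (reflect-below T (s≤s J<I))
                       (reflect-below T J<I) (unchanged (<⇒≢ J<I))
... | tri≈ _ refl _ = rerouted-at (reflect-below T (n<1+n I))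
                        (trans (reflect-inside ≤-refl I<T) (m+n∸m≡n (suc I) T))
                        (trans (reflect-inside ≤-refl (<⇒≤ I<T)) (m+n∸m≡n I T))
                        (edge-x-yₜ refl refl , old-edge (inj₁ refl) (λ (_ , T≡I) → >⇒≢ I<T T≡I))
... | tri> _ _ I<J with <-cmp J T
...   | tri< J<T _ _ = rerouted-at
          (trans (reflect-inside I<J (<⇒≤ J<T)) (+-∸-assoc 1 (≤-trans (<⇒≤ J<T) (m≤n+m T I))))
          (reflect-inside (s≤s (<⇒≤ I<J)) J<T) (reflect-inside (<⇒≤ I<J) (<⇒≤ J<T))
          (old-edge (inj₂ refl) y≢I , old-edge (inj₁ refl) y≢I)
  where
  I<y : I < I + T ∸ J
  I<y = ≤-trans (m<m+n I (m<n⇒0<n∸m J<T)) (≤-reflexive (sym (+-∸-assoc I (<⇒≤ J<T))))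
  y≢I : ∀ {A} → ¬ (A ≡ I × I + T ∸ J ≡ I)
  y≢I (_ , y≡I) = >⇒≢ I<y y≡I
...   | tri≈ _ refl _ = rerouted-at
          (trans (reflect-inside I<J ≤-refl) (m+n∸n≡m (suc I) J)) (reflect-above (suc I) (n<1+n J))
          (trans (reflect-inside (<⇒≤ I<J) ≤-refl) (m+n∸n≡m I J))
          (old-edge (inj₂ refl) (λ (1+I≡I , _) → 1+n≢n 1+I≡I) , edge-xₜ₊₁-y refl refl)
...   | tri> _ _ T<J = rerouted-at (reflect-above (suc I) T<J) (reflect-above (suc I) (m<n⇒m<1+n T<J))
                         (reflect-above I T<J) (unchanged (>⇒≢ I<J))

-- For t < i the rotated path is x₀ … y_t x_i y_{i-1} … y_{t+1} x_{t+1} y_i x_{i+1} …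
rerouted-backward : ∀ {I T} → T < I → ∀ J →
  EdgePair (Rerouted I T) (reflect (suc T) I) (reflect (suc T) (pred I)) J
rerouted-backward {suc I} {T} T<1+I J with <-cmp J T
... | tri< J<T _ _ = rerouted-at (reflect-below (suc I) (m<n⇒m<1+n J<T)) (reflect-below (suc I) (s≤s J<T))
                       (reflect-below I (m<n⇒m<1+n J<T)) (unchanged (<⇒≢ (<-trans J<T T<1+I)))
... | tri≈ _ refl _ = rerouted-at (reflect-below (suc I) (n<1+n J))
                        (trans (reflect-inside ≤-refl T<1+I) (m+n∸m≡n (suc J) (suc I)))
                        (reflect-below I (n<1+n J))
                        (old-edge (inj₁ refl) (λ (J≡1+I , _) → <⇒≢ T<1+I J≡1+I) , edge-x-yₜ refl refl)
... | tri> _ _ T<J with <-cmp J (suc I)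
...   | tri< J<1+I _ _ = rerouted-at
          (trans (reflect-inside T<J (<⇒≤ J<1+I))
                 (trans (cong (_∸ J) (+-suc (suc T) I))
                        (+-∸-assoc 1 (≤-trans (≤-pred J<1+I) (m≤n+m I (suc T))))))
          (trans (reflect-inside (s≤s (<⇒≤ T<J)) J<1+I) (cong (_∸ J) (+-suc T I)))
          (reflect-inside T<J (≤-pred J<1+I))
          (old-edge (inj₂ refl) y≢1+I , old-edge (inj₁ refl) y≢1+I)
  where
  y≢1+I : ∀ {A} → ¬ (A ≡ suc I × suc T + I ∸ J ≡ suc I)
  y≢1+I (_ , y≡1+I) = <⇒≢ (s≤s (lo+hi∸j≤hi I T<J)) y≡1+I
...   | tri≈ _ refl _ = rerouted-at
          (trans (reflect-inside T<1+I ≤-refl) (m+n∸n≡m (suc T) (suc I)))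
          (reflect-above (suc T) (n<1+n (suc I))) (reflect-above (suc T) (n<1+n I))
          (edge-xₜ₊₁-y refl refl , old-edge (inj₂ refl) (λ (2+I≡1+I , _) → 1+n≢n 2+I≡1+I))
...   | tri> _ _ 1+I<J = rerouted-at
          (reflect-above (suc T) 1+I<J) (reflect-above (suc T) (m<n⇒m<1+n 1+I<J))
          (reflect-above (suc T) (<-trans (n<1+n I) 1+I<J)) (unchanged (>⇒≢ 1+I<J))

module Rotation {a b} (K : BGraph a b) {x y} {WX : Subset a} {WY : Subset b} {u v k}
  {f : Fin (suc k) → Fin a} {g : Fin k → Fin b}
  (f-inj : Injective _≡_ _≡_ f) (g-inj : Injective _≡_ _≡_ g)
  (f-covers : Covers (∁ WX) f) (g-covers : Covers (∁ WY) g)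
  (f₀≡u : f zero ≡ u) (fₖ≡v : f (fromℕ k) ≡ v) (edges : PathEdges (addEdge K x y) f g)
  (i : Fin k) (fi≡x : f (inject₁ i) ≡ x) (gi≡y : g i ≡ y) where

  rerouted-edge : ∀ {t} → Adj K x (g t) → Adj K (f (suc t)) y →
    ∀ a′ b′ → Rerouted (toℕ i) (toℕ t) (toℕ a′) (toℕ b′) → Adj K (f a′) (g b′)
  rerouted-edge _ _ a′ b′ (old-edge onPath ab≢ii) =
    Adj-addEdge⇒Adj K (PathEdges⇒Adj {G = addEdge K x y} {f} {g} edges a′ b′ onPath)
      (λ (fa≡x , gb≡y) → ab≢ii
        ( trans (cong toℕ (f-inj (trans fa≡x (sym fi≡x)))) (Finₚ.toℕ-inject₁ i)
        , cong toℕ (g-inj (trans gb≡y (sym gi≡y)))))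
  rerouted-edge Kxgt _ a′ b′ (edge-x-yₜ a≡i b≡t) = subst₂ (Adj K)
    (sym (trans (cong f (Finₚ.toℕ-injective (trans a≡i (sym (Finₚ.toℕ-inject₁ i))))) fi≡x))
    (sym (cong g (Finₚ.toℕ-injective b≡t))) Kxgt
  rerouted-edge {t} _ Kft₊₁y a′ b′ (edge-xₜ₊₁-y a≡1+t b≡i) = subst₂ (Adj K)
    (sym (cong f (Finₚ.toℕ-injective {j = suc t} a≡1+t)))
    (sym (trans (cong g (Finₚ.toℕ-injective b≡i)) gi≡y)) Kft₊₁y

  rerouted-path : ∀ {t} lo hi lo′ hi′ (hi<1+k : hi < suc k) (hi′<k : hi′ < k) → 0 < lo → hi < k →
    Adj K x (g t) → Adj K (f (suc t)) y →
    (∀ J → EdgePair (Rerouted (toℕ i) (toℕ t)) (reflect lo hi) (reflect lo′ hi′) J) →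
    HamPath K (∁ WX) (∁ WY) u v
  rerouted-path {t} lo hi lo′ hi′ hi<1+k hi′<k 0<lo hi<k Kxgt Kft₊₁y pairs =
    permuted-path {G = K} f-inj g-inj f-covers g-covers ρ (reflectFin lo′ hi′ hi′<k)
      (reflectFin-involutive lo hi hi<1+k) (reflectFin-involutive lo′ hi′ hi′<k)
      (trans (cong f first-fixed) f₀≡u) (trans (cong f last-fixed) fₖ≡v)
      (reflected-edges {G = K} {f} {g} lo hi lo′ hi′ hi<1+k hi′<k (Rerouted (toℕ i) (toℕ t))
        (rerouted-edge Kxgt Kft₊₁y) (λ J _ → pairs J))
    where
    open ≡-Reasoning
    ρ = reflectFin lo hi hi<1+k
    first-fixed : ρ zero ≡ zero
    first-fixed = Finₚ.toℕ-injective (trans (toℕ-reflectFin lo hi hi<1+k zero) (reflect-below hi 0<lo))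
    last-fixed : ρ (fromℕ k) ≡ fromℕ k
    last-fixed = Finₚ.toℕ-injective (begin
      toℕ (ρ (fromℕ k))              ≡⟨ toℕ-reflectFin lo hi hi<1+k (fromℕ k) ⟩
      reflect lo hi (toℕ (fromℕ k))  ≡⟨ cong (reflect lo hi) (Finₚ.toℕ-fromℕ k) ⟩
      reflect lo hi k                ≡⟨ reflect-above lo hi<k ⟩
      k                              ≡⟨ Finₚ.toℕ-fromℕ k ⟨
      toℕ (fromℕ k)                  ∎)

  reroute : (t : Fin k) → t ≢ i → Adj K x (g t) → Adj K (f (suc t)) y → HamPath K (∁ WX) (∁ WY) u v
  reroute t t≢i Kxgt Kft₊₁y with <-cmp (toℕ i) (toℕ t)
  ... | tri< i<t _ _ = rerouted-path (suc (toℕ i)) (toℕ t) (toℕ i) (toℕ t)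
        (m<n⇒m<1+n (Finₚ.toℕ<n t)) (Finₚ.toℕ<n t) z<s (Finₚ.toℕ<n t) Kxgt Kft₊₁y
        (rerouted-forward i<t)
  ... | tri≈ _ i≡t _ = contradiction (Finₚ.toℕ-injective (sym i≡t)) t≢i
  ... | tri> _ _ t<i = rerouted-path (suc (toℕ t)) (toℕ i) (suc (toℕ t)) (pred (toℕ i))
        (m<n⇒m<1+n (Finₚ.toℕ<n i)) (≤-<-trans pred[n]≤n (Finₚ.toℕ<n i)) z<s (Finₚ.toℕ<n i) Kxgt Kft₊₁y
        (rerouted-backward t<i)

  degree-sum≤ : (∀ t → ⟦ K x (g t) ⟧ + ⟦ K (f (suc t)) y ⟧ ≤ 1) →
    degX K x + degY K y ≤ suc b + ∣ WX ∣
  degree-sum≤ at-most-one = begin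
    degX K x + degY K y
      ≤⟨ +-mono-≤ (∣tabulate∣≤∑∘+∣W∣ (K x) g WY (λ z → proj₁ (g-covers z)))
                  (∣tabulate∣≤∑∘+∣W∣ (λ a′ → K a′ y) f WX (λ z → proj₁ (f-covers z))) ⟩
    (A + ∣ WY ∣) + ((⟦ K (f zero) y ⟧ + B) + ∣ WX ∣)
      ≤⟨ +-monoʳ-≤ (A + ∣ WY ∣) (+-monoˡ-≤ ∣ WX ∣ (+-monoˡ-≤ B (⟦⟧≤1 (K (f zero) y)))) ⟩
    (A + ∣ WY ∣) + ((1 + B) + ∣ WX ∣)
      ≡⟨ regroup A B ∣ WY ∣ ∣ WX ∣ ⟩
    suc (A + B + ∣ WY ∣) + ∣ WX ∣
      ≤⟨ +-monoˡ-≤ ∣ WX ∣ (s≤s (+-monoˡ-≤ ∣ WY ∣ A+B≤k)) ⟩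
    suc (k + ∣ WY ∣) + ∣ WX ∣
      ≤⟨ +-monoˡ-≤ ∣ WX ∣ (s≤s (injective⇒k+∣W∣≤n WY g-inj (λ t → proj₂ (g-covers (g t)) t refl))) ⟩
    suc b + ∣ WX ∣
      ∎
    where
    open ≤-Reasoning
    regroup : ∀ a b c d → (a + c) + ((1 + b) + d) ≡ suc (a + b + c) + d
    regroup = solve-∀
    A = ∑[ t < k ] ⟦ K x (g t) ⟧
    B = ∑[ t < k ] ⟦ K (f (suc t)) y ⟧
    A+B≤k : A + B ≤ k
    A+B≤k = begin
      A + B
        ≡⟨ ∑-distrib-+ (λ t → ⟦ K x (g t) ⟧) (λ t → ⟦ K (f (suc t)) y ⟧) ⟨
      (∑[ t < k ] (⟦ K x (g t) ⟧ + ⟦ K (f (suc t)) y ⟧))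
        ≤⟨ ∑-mono-≤ at-most-one ⟩
      (∑[ t < k ] 1)
        ≡⟨ ∑-one k ⟩
      k ∎

  rotation-exists : K x y ≡ false → suc b + ∣ WX ∣ < degX K x + degY K y →
    ∃ λ t → t ≢ i × Adj K x (g t) × Adj K (f (suc t)) y
  rotation-exists Kxy≡false heavy
    with Finₚ.any? (λ t → ¬? (t ≟ i) ×-dec ((K x (g t) Boolₚ.≟ true) ×-dec (K (f (suc t)) y Boolₚ.≟ true)))
  ... | yes found = found
  ... | no none = contradiction (degree-sum≤ at-most-one) (<⇒≱ heavy)
    where
    at-most-one : ∀ t → ⟦ K x (g t) ⟧ + ⟦ K (f (suc t)) y ⟧ ≤ 1
    at-most-one t with t ≟ i
    ... | yes refl rewrite gi≡y | Kxy≡false = ⟦⟧≤1 (K (f (suc i)) y)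
    ... | no t≢i with K x (g t) in Kxgt | K (f (suc t)) y in Kft₊₁y
    ...   | true  | true  = contradiction (t , t≢i , Kxgt , Kft₊₁y) none
    ...   | true  | false = ≤-refl
    ...   | false | c     = ⟦⟧≤1 c

  rotated-path : K x y ≡ false → suc b + ∣ WX ∣ < degX K x + degY K y → HamPath K (∁ WX) (∁ WY) u v
  rotated-path Kxy≡false heavy with rotation-exists Kxy≡false heavy
  ... | t , t≢i , Kxgt , Kft₊₁y = reroute t t≢i Kxgt Kft₊₁y

module _ {a b} (K : BGraph a b) {x y} {WX : Subset a} {WY : Subset b}
  (Kxy≡false : K x y ≡ false) (heavy : suc b + ∣ WX ∣ < degX K x + degY K y) where

  addEdge-reflects-HamPath-forward : ∀ {u v} (P : HamPath (addEdge K x y) (∁ WX) (∁ WY) u v) →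
    PassesForward {G = addEdge K x y} P x y → HamPath K (∁ WX) (∁ WY) u v
  addEdge-reflects-HamPath-forward (hamPath k f g f-inj g-inj f-covers g-covers f₀≡u fₖ≡v edges)
                                   (i , fi≡x , gi≡y) =
    Rotation.rotated-path K f-inj g-inj f-covers g-covers f₀≡u fₖ≡v edges i fi≡x gi≡y Kxy≡false heavy

  addEdge-reflects-HamPath : ∀ {u v} →
    HamPath (addEdge K x y) (∁ WX) (∁ WY) u v → HamPath K (∁ WX) (∁ WY) u v
  addEdge-reflects-HamPath P@(hamPath k f g f-inj g-inj f-covers g-covers f₀≡u fₖ≡v edges)
    with Finₚ.any? (λ j → (f (inject₁ j) ≟ x) ×-dec (g j ≟ y))
       | Finₚ.any? (λ j → (f (suc j) ≟ x) ×-dec (g j ≟ y))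
  ... | yes forward | _ = addEdge-reflects-HamPath-forward P forward
  ... | no _ | yes backward = HamPath-reverse {G = K}
          (addEdge-reflects-HamPath-forward (HamPath-reverse {G = addEdge K x y} P)
            (HamPath-reverse-passes {G = addEdge K x y} P backward))
  ... | no ¬forward | no ¬backward = hamPath k f g f-inj g-inj f-covers g-covers f₀≡u fₖ≡v
          (λ j → Adj-addEdge⇒Adj K (proj₁ (edges j)) (λ e → ¬forward (j , e))
               , Adj-addEdge⇒Adj K (proj₂ (edges j)) (λ e → ¬backward (j , e)))

addEdge-reflects-HamBiconnected2p : ∀ {a b} p (K : BGraph a b) x y →
  K x y ≡ false → suc b + p < degX K x + degY K y →
  HamBiconnected2p p (addEdge K x y) → HamBiconnected2p p K
addEdge-reflects-HamBiconnected2p {b = b} p K x y Kxy≡false heavy L-ham WX WY ∣WX∣≡p ∣WY∣≡p u v u∈ v∈ u≢v =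
  addEdge-reflects-HamPath K Kxy≡false (subst (λ w → suc b + w < degX K x + degY K y) (sym ∣WX∣≡p) heavy)
    (L-ham WX WY ∣WX∣≡p ∣WY∣≡p u v u∈ v∈ u≢v)

lemma2p5 : (m p : ℕ) (G H : BGraph (suc m) m) →
    IsBiclosure (suc m + p + 1) G H →
    (HamBiconnected2p p G → HamBiconnected2p p H) ×
    (HamBiconnected2p p H → HamBiconnected2p p G)
lemma2p5 m p G H closure@(G⊆H , _) =
  HamBiconnected2p-mono p G⊆H ,
  biclosure-reflects (suc m + p + 1) (HamBiconnected2p p) (HamBiconnected2p-mono p) removable closure
  where
  removable : ∀ K x y → K x y ≡ false → suc m + p + 1 ≤ degX K x + degY K y →
    HamBiconnected2p p (addEdge K x y) → HamBiconnected2p p K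
  removable K x y Kxy≡false heavy = addEdge-reflects-HamBiconnected2p p K x y Kxy≡false
    (subst (_≤ degX K x + degY K y) (+-comm (suc m + p) 1) heavy)
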